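{- Let $G$ be a connected graph of order $n\geq 3$. Then (1) $sdiam_{n-1}(G)=n-2$ if and only if $G$ is $2$-connected; and (2) $sdiam_{n-1}(G)=n-1$ if and only if $G$ contains at least one cut vertex.
   Context: For $S\subseteq V(G)$, the Steiner distance $d_G(S)$ is the minimum number of edges of a connected subgraph of $G$ whose vertex set contains $S$. For $2\leq m\leq n$, the Steiner $m$-diameter is $sdiam_m(G)=\max\{d_G(S): S\subseteq V(G),\ |S|=m\}$. A cut vertex is a vertex whose removal disconnects $G$; $G$ is $2$-connected if its vertex connectivity $\kappa(G)$ is at least $2$. -}

module Defs where

open import Data.Nat using (ℕ; zero; suc; _≤_; _<ᵇ_)
open import Data.Bool using (Bool; true; false; _∧_; if_then_else_)
open import Data.Fin using (Fin; toℕ)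
open import Data.Fin.Subset using (Subset; _∈_; _⊆_; ∣_∣)
open import Data.List using (List; map; allFin)
open import Data.Nat.ListAction using (sum)
open import Data.Product using (Σ; _×_; ∃; ∃-syntax)
open import Relation.Binary.PropositionalEquality using (_≡_; _≢_)
open import Relation.Nullary using (¬_)
open import Data.Unit using (⊤)

record Graph (n : ℕ) : Set where
  field
    adj     : Fin n → Fin n → Bool
    adj-sym : ∀ i j → adj i j ≡ adj j i
    irrefl  : ∀ i → adj i i ≡ false
open Graph public

data WalkIn {n : ℕ} (E : Fin n → Fin n → Bool) (P : Fin n → Set) : Fin n → Fin n → Set where
  here : ∀ {u} → P u → WalkIn E P u u
  step : ∀ {u v w} → P u → E u v ≡ true → WalkIn E P v w → WalkIn E P u w

Connected : ∀ {n} → Graph n → Set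
Connected {n} G = ∀ (u v : Fin n) → WalkIn (adj G) (λ _ → ⊤) u v

ConnectedWithout : ∀ {n} → Graph n → Fin n → Set
ConnectedWithout {n} G x =
  ∀ (u v : Fin n) → u ≢ x → v ≢ x → WalkIn (adj G) (λ w → w ≢ x) u v

IsCutVertex : ∀ {n} → Graph n → Fin n → Set
IsCutVertex G x = ¬ ConnectedWithout G x

HasCutVertex : ∀ {n} → Graph n → Set
HasCutVertex {n} G = ∃[ x ] IsCutVertex G x

TwoConnected : ∀ {n} → Graph n → Set
TwoConnected {n} G = (2 Data.Nat.< n) × Connected G × (∀ x → ConnectedWithout G x)
  where import Data.Nat

record Subgraph {n : ℕ} (G : Graph n) : Set where
  field
    U     : Subset n
    E     : Fin n → Fin n → Bool
    E-sym : ∀ i j → E i j ≡ E j i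
    E-sub : ∀ i j → E i j ≡ true → (adj G i j ≡ true) × (i ∈ U) × (j ∈ U)
open Subgraph public

edgeCount : ∀ {n} {G : Graph n} → Subgraph G → ℕ
edgeCount {n} H =
  sum (map (λ i → sum (map (λ j → if (toℕ i <ᵇ toℕ j) ∧ E H i j then 1 else 0)
                            (allFin n)))
           (allFin n))

SubConnected : ∀ {n} {G : Graph n} → Subgraph G → Set
SubConnected {n} H = ∀ (u v : Fin n) → u ∈ U H → v ∈ U H → WalkIn (E H) (λ w → w ∈ U H) u v

IsSteinerDist : ∀ {n} → Graph n → Subset n → ℕ → Set
IsSteinerDist G S k =
  (Σ (Subgraph G) λ H → SubConnected H × S ⊆ U H × edgeCount H ≡ k)
  × (∀ (H : Subgraph G) → SubConnected H → S ⊆ U H → k ≤ edgeCount H)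

IsSdiam : ∀ {n} → Graph n → ℕ → ℕ → Set
IsSdiam {n} G m k =
  (Σ (Subset n) λ S → ∣ S ∣ ≡ m × IsSteinerDist G S k)
  × (∀ (S : Subset n) → ∣ S ∣ ≡ m → ∀ d → IsSteinerDist G S d → d ≤ k)

module Submission where

-- Growing a maximal tree from a root r, one edge at a time, yields a tree on exactly the
-- vertices reachable from r, with one edge fewer than vertices.  Hence a connected subgraph
-- with k vertices has at least k - 1 edges, and a connected vertex set W spans a tree with
-- |W| - 1 edges.  Let |S| = n - 1 and let x be the vertex outside S.  If G - x is connected,
-- a spanning tree of G - x gives d(S) = n - 2.  If x is a cut vertex, a connected subgraph
-- containing S must also contain x, so it has n vertices and d(S) = n - 1, attained by a
-- spanning tree of G.  The case split is constructive because whether G - x is connected is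
-- decided by checking whether the maximal tree grown in G - x covers all of G - x.

open import Defs
open import Algebra.Properties.CommutativeSemigroup using (interchange)
open import Data.Bool using (Bool; true; false; _∧_; _∨_; if_then_else_)
open import Data.Bool.Properties using (∧-identityʳ; ∧-zeroʳ; ∧-comm; ∨-comm; ∨-zeroʳ) renaming (_≟_ to _≟ᴮ_)
open import Data.Empty using (⊥; ⊥-elim)
open import Data.Fin using (Fin; zero; suc; toℕ)
open import Data.Fin.Properties using (_≟_; suc-injective; toℕ-injective; any?; all?)
open import Data.Fin.Subset using (Subset; _∈_; _∉_; _⊆_; ∣_∣; ⁅_⁆; _∪_; ∁; ⊤; inside; outside)
open import Data.Fin.Subset.Properties
  using (_∈?_; ∈⊤; ⊆⊤; ⊆-antisym; ∣p∣≤n; ∣⊤∣≡n; p⊆q⇒∣p∣≤∣q∣; ∣∁p∣≡n∸∣p∣; ∣⁅x⁆∣≡1; ∪-identityʳ;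
         x∈⁅x⁆; x∈⁅y⁆⇒x≡y; x∈p∪q⁺; x∈p∪q⁻; x∈∁p⇒x∉p; x∉p⇒x∈∁p; x∉⁅y⁆⇒x≢y; x≢y⇒x∉⁅y⁆)
open import Data.List using ([]; _∷_; map; allFin)
open import Data.List.Properties using (map-cong; map-tabulate)
open import Data.Nat using (ℕ; zero; suc; _+_; _∸_; _≤_; _<_; z≤n; s≤s; _<ᵇ_)
open import Data.Nat.ListAction using (sum)
open import Data.Nat.Properties
  using (≤-refl; 1+n≰n; n≤1+n; +-mono-≤; ∸-monoˡ-≤; +-identityʳ; +-comm; +-suc; ∸-+-assoc;
         +-commutativeSemigroup; module ≤-Reasoning)
open import Data.Product using (Σ; ∃; _×_; _,_; proj₁; proj₂)
open import Data.Sum using (_⊎_; inj₁; inj₂; map₂)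
open import Data.Vec using (_∷_; here; there)
open import Function using (_∘_; id)
open import Function.Bundles using (_⇔_; mk⇔)
open import Relation.Binary.PropositionalEquality
  using (_≡_; _≢_; refl; sym; trans; cong; cong₂; subst; module ≡-Reasoning)
open import Relation.Nullary using (¬_; Dec; does; yes; no)
open import Relation.Nullary.Decidable using (map′; dec-true; decidable-stable; ¬?; _×-dec_; _→-dec_)
open import Relation.Unary using (Decidable)

sum-map-mono : ∀ {A : Set} {f g : A → ℕ} → (∀ x → f x ≤ g x) →
               ∀ xs → sum (map f xs) ≤ sum (map g xs)
sum-map-mono f≤g []       = z≤n
sum-map-mono f≤g (x ∷ xs) = +-mono-≤ (f≤g x) (sum-map-mono f≤g xs)

sum-map-+ : ∀ {A : Set} (f g : A → ℕ) xs →
            sum (map (λ x → f x + g x) xs) ≡ sum (map f xs) + sum (map g xs)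
sum-map-+ f g []       = refl
sum-map-+ f g (x ∷ xs) =
  trans (cong ((f x + g x) +_) (sum-map-+ f g xs)) (interchange +-commutativeSemigroup (f x) (g x) _ _)

sum-map-zero : ∀ {A : Set} {f : A → ℕ} → (∀ x → f x ≡ 0) → ∀ xs → sum (map f xs) ≡ 0
sum-map-zero f≡0 []       = refl
sum-map-zero f≡0 (x ∷ xs) = cong₂ _+_ (f≡0 x) (sum-map-zero f≡0 xs)

sumFin : ∀ {n} → (Fin n → ℕ) → ℕ
sumFin {n} f = sum (map f (allFin n))

sumFin-cong : ∀ {n} {f g : Fin n → ℕ} → (∀ i → f i ≡ g i) → sumFin f ≡ sumFin g
sumFin-cong {n} f≗g = cong sum (map-cong f≗g (allFin n))

sumFin-mono : ∀ {n} {f g : Fin n → ℕ} → (∀ i → f i ≤ g i) → sumFin f ≤ sumFin g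
sumFin-mono {n} f≤g = sum-map-mono f≤g (allFin n)

sumFin-+ : ∀ {n} (f g : Fin n → ℕ) → sumFin (λ i → f i + g i) ≡ sumFin f + sumFin g
sumFin-+ {n} f g = sum-map-+ f g (allFin n)

sumFin-zero : ∀ {n} {f : Fin n → ℕ} → (∀ i → f i ≡ 0) → sumFin f ≡ 0
sumFin-zero {n} f≡0 = sum-map-zero f≡0 (allFin n)

sumFin-suc : ∀ {n} (f : Fin (suc n) → ℕ) → sumFin f ≡ f zero + sumFin (f ∘ suc)
sumFin-suc {n} f =
  cong (f zero +_) (cong sum (trans (map-tabulate suc f) (sym (map-tabulate id (f ∘ suc)))))

sumFin-point : ∀ {n} (a : Fin n) {f : Fin n → ℕ} → (∀ i → i ≢ a → f i ≡ 0) → sumFin f ≡ f a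
sumFin-point {suc n} zero {f} off = begin
  sumFin f                    ≡⟨ sumFin-suc f ⟩
  f zero + sumFin (f ∘ suc)   ≡⟨ cong (f zero +_) (sumFin-zero (λ i → off (suc i) λ ())) ⟩
  f zero + 0                  ≡⟨ +-identityʳ (f zero) ⟩
  f zero                      ∎
  where open ≡-Reasoning
sumFin-point {suc n} (suc a) {f} off = begin
  sumFin f                    ≡⟨ sumFin-suc f ⟩
  f zero + sumFin (f ∘ suc)   ≡⟨ cong₂ _+_ (off zero λ ()) (sumFin-point a (λ i i≢a → off (suc i) (i≢a ∘ suc-injective))) ⟩
  f (suc a)                   ∎
  where open ≡-Reasoning

Edges : ℕ → Set
Edges n = Fin n → Fin n → Bool

_⊆ᴱ_ : ∀ {n} → Edges n → Edges n → Set
E ⊆ᴱ E′ = ∀ {i j} → E i j ≡ true → E′ i j ≡ true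

-- Each unordered edge {i, j} is counted once, at its orientation i < j.
upperEdge : ∀ {n} → Edges n → Fin n → Fin n → ℕ
upperEdge E i j = if (toℕ i <ᵇ toℕ j) ∧ E i j then 1 else 0

countEdges : ∀ {n} → Edges n → ℕ
countEdges E = sumFin λ i → sumFin (upperEdge E i)

indicator-∧-mono : ∀ b x y → (x ≡ true → y ≡ true) →
                   (if b ∧ x then 1 else 0) ≤ (if b ∧ y then 1 else 0)
indicator-∧-mono false _     _ _   = z≤n
indicator-∧-mono true  false _ _   = z≤n
indicator-∧-mono true  true  y x⇒y rewrite x⇒y refl = ≤-refl

indicator-∧-false : ∀ b {x} → x ≡ false → (if b ∧ x then 1 else 0) ≡ 0
indicator-∧-false b x≡false rewrite x≡false | ∧-zeroʳ b = refl

indicator-∧-∨ : ∀ b x y → (x ≡ true → y ≡ true → ⊥) →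
                (if b ∧ (x ∨ y) then 1 else 0) ≡ (if b ∧ x then 1 else 0) + (if b ∧ y then 1 else 0)
indicator-∧-∨ false _     _     _ = refl
indicator-∧-∨ true  false _     _ = refl
indicator-∧-∨ true  true  false _ = refl
indicator-∧-∨ true  true  true  disjoint = ⊥-elim (disjoint refl refl)

countEdges-mono : ∀ {n} {E E′ : Edges n} → E ⊆ᴱ E′ → countEdges E ≤ countEdges E′
countEdges-mono {E = E} {E′} E⊆E′ = sumFin-mono λ i → sumFin-mono λ j →
  indicator-∧-mono (toℕ i <ᵇ toℕ j) (E i j) (E′ i j) E⊆E′

countEdges-∨ : ∀ {n} (E E′ : Edges n) → (∀ i j → E i j ≡ true → E′ i j ≡ true → ⊥) →
               countEdges (λ i j → E i j ∨ E′ i j) ≡ countEdges E + countEdges E′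
countEdges-∨ E E′ disjoint = trans
  (sumFin-cong λ i → trans (sumFin-cong λ j → indicator-∧-∨ (toℕ i <ᵇ toℕ j) (E i j) (E′ i j) (disjoint i j))
                           (sumFin-+ (upperEdge E i) (upperEdge E′ i)))
  (sumFin-+ (λ i → sumFin (upperEdge E i)) (λ i → sumFin (upperEdge E′ i)))

countEdges-∅ : ∀ {n} → countEdges {n} (λ _ _ → false) ≡ 0
countEdges-∅ {n} = sumFin-zero {n} λ i → sumFin-zero {n} λ j → indicator-∧-false (toℕ i <ᵇ toℕ j) refl

arc : ∀ {n} → Fin n → Fin n → Edges n
arc u v i j = does (i ≟ u) ∧ does (j ≟ v)

arc-sound : ∀ {n} {u v : Fin n} i j → arc u v i j ≡ true → i ≡ u × j ≡ v
arc-sound {u = u} {v} i j a with i ≟ u | j ≟ v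
... | yes i≡u | yes j≡v = i≡u , j≡v

arc-complete : ∀ {n} (u v : Fin n) → arc u v u v ≡ true
arc-complete u v rewrite dec-true (u ≟ u) refl | dec-true (v ≟ v) refl = refl

arc-off : ∀ {n} {u v : Fin n} i j → ¬ (i ≡ u × j ≡ v) → arc u v i j ≡ false
arc-off {u = u} {v} i j ¬uv with arc u v i j in a
... | true  = ⊥-elim (¬uv (arc-sound i j a))
... | false = refl

countEdges-arc : ∀ {n} (u v : Fin n) → countEdges (arc u v) ≡ (if toℕ u <ᵇ toℕ v then 1 else 0)
countEdges-arc u v = begin
  countEdges (arc u v)                                         ≡⟨ sumFin-point u (λ i i≢u → sumFin-zero λ j → off i j (i≢u ∘ proj₁)) ⟩
  sumFin (upperEdge (arc u v) u)                               ≡⟨ sumFin-point v (λ j j≢v → off u j (j≢v ∘ proj₂)) ⟩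
  upperEdge (arc u v) u v                                      ≡⟨ cong (λ b → if (toℕ u <ᵇ toℕ v) ∧ b then 1 else 0) (arc-complete u v) ⟩
  (if (toℕ u <ᵇ toℕ v) ∧ true then 1 else 0)                   ≡⟨ cong (λ b → if b then 1 else 0) (∧-identityʳ _) ⟩
  (if toℕ u <ᵇ toℕ v then 1 else 0)                            ∎
  where
    open ≡-Reasoning
    off : ∀ i j → ¬ (i ≡ u × j ≡ v) → upperEdge (arc u v) i j ≡ 0
    off i j ¬uv = indicator-∧-false (toℕ i <ᵇ toℕ j) (arc-off i j ¬uv)

<ᵇ-indicator-sum : ∀ {m n} → m ≢ n → (if m <ᵇ n then 1 else 0) + (if n <ᵇ m then 1 else 0) ≡ 1
<ᵇ-indicator-sum {zero}  {zero}  m≢n = ⊥-elim (m≢n refl)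
<ᵇ-indicator-sum {zero}  {suc n} _   = refl
<ᵇ-indicator-sum {suc m} {zero}  _   = refl
<ᵇ-indicator-sum {suc m} {suc n} m≢n = <ᵇ-indicator-sum (m≢n ∘ cong suc)

edge : ∀ {n} → Fin n → Fin n → Edges n
edge u v i j = arc u v i j ∨ arc v u i j

edge-sym : ∀ {n} (u v i j : Fin n) → edge u v i j ≡ edge u v j i
edge-sym u v i j rewrite ∧-comm (does (i ≟ u)) (does (j ≟ v)) | ∧-comm (does (i ≟ v)) (does (j ≟ u)) =
  ∨-comm (does (j ≟ v) ∧ does (i ≟ u)) _

edge-sound : ∀ {n} {u v : Fin n} i j → edge u v i j ≡ true → (i ≡ u × j ≡ v) ⊎ (i ≡ v × j ≡ u)
edge-sound {u = u} {v} i j e with arc u v i j in a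
... | true  = inj₁ (arc-sound i j a)
... | false = inj₂ (arc-sound i j e)

edge-complete : ∀ {n} (u v : Fin n) → edge u v u v ≡ true
edge-complete u v rewrite arc-complete u v = refl

countEdges-edge : ∀ {n} {u v : Fin n} → u ≢ v → countEdges (edge u v) ≡ 1
countEdges-edge {u = u} {v} u≢v = begin
  countEdges (edge u v)                     ≡⟨ countEdges-∨ (arc u v) (arc v u) disjoint ⟩
  countEdges (arc u v) + countEdges (arc v u) ≡⟨ cong₂ _+_ (countEdges-arc u v) (countEdges-arc v u) ⟩
  _                                         ≡⟨ <ᵇ-indicator-sum (u≢v ∘ toℕ-injective) ⟩
  1                                         ∎
  where
    open ≡-Reasoning
    disjoint : ∀ i j → arc u v i j ≡ true → arc v u i j ≡ true → ⊥
    disjoint i j a a′ = u≢v (trans (sym (proj₁ (arc-sound i j a))) (proj₁ (arc-sound i j a′)))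

module _ {n : ℕ} {E : Edges n} {P : Fin n → Set} where

  walk-head : ∀ {u v} → WalkIn E P u v → P u
  walk-head (here pu)     = pu
  walk-head (step pu _ _) = pu

  _++ʷ_ : ∀ {u v w} → WalkIn E P u v → WalkIn E P v w → WalkIn E P u w
  here _        ++ʷ q = q
  step pu e p   ++ʷ q = step pu e (p ++ʷ q)

  walk-reverse : (∀ i j → E i j ≡ E j i) → ∀ {u v} → WalkIn E P u v → WalkIn E P v u
  walk-reverse E-sym (here pu)     = here pu
  walk-reverse E-sym (step pu e p) = walk-reverse E-sym p ++ʷ step (walk-head p) (trans (E-sym _ _) e) (here pu)

  walk-via : (∀ i j → E i j ≡ E j i) → ∀ {r u v} → WalkIn E P r u → WalkIn E P r v → WalkIn E P u v
  walk-via E-sym p q = walk-reverse E-sym p ++ʷ q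

walk-map : ∀ {n} {E E′ : Edges n} {P Q : Fin n → Set} → E ⊆ᴱ E′ → (∀ {w} → P w → Q w) →
           ∀ {u v} → WalkIn E P u v → WalkIn E′ Q u v
walk-map E⊆E′ P⇒Q (here pu)     = here (P⇒Q pu)
walk-map E⊆E′ P⇒Q (step pu e p) = step (P⇒Q pu) (E⊆E′ e) (walk-map E⊆E′ P⇒Q p)

∣p∪⁅x⁆∣≡1+∣p∣ : ∀ {n} (p : Subset n) {x : Fin n} → x ∉ p → ∣ p ∪ ⁅ x ⁆ ∣ ≡ suc ∣ p ∣
∣p∪⁅x⁆∣≡1+∣p∣ (outside ∷ p) {zero}  _   = cong (suc ∘ ∣_∣) (∪-identityʳ p)
∣p∪⁅x⁆∣≡1+∣p∣ (inside  ∷ p) {zero}  x∉p = ⊥-elim (x∉p here)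
∣p∪⁅x⁆∣≡1+∣p∣ (outside ∷ p) {suc x} x∉p = ∣p∪⁅x⁆∣≡1+∣p∣ p (x∉p ∘ there)
∣p∪⁅x⁆∣≡1+∣p∣ (inside  ∷ p) {suc x} x∉p = cong suc (∣p∪⁅x⁆∣≡1+∣p∣ p (x∉p ∘ there))

∨-≡true : ∀ x {y} → x ∨ y ≡ true → x ≡ true ⊎ y ≡ true
∨-≡true true  _ = inj₁ refl
∨-≡true false e = inj₂ e

-- Growing a maximal tree

module SpanningTree {n : ℕ} (E : Edges n) (E-sym : ∀ i j → E i j ≡ E j i)
                    {P : Fin n → Set} (P? : Decidable P) (r : Fin n) (Pr : P r) where

  record Tree : Set where
    field
      vertices   : Subset n
      edges      : Edges n
      root∈      : r ∈ vertices
      vertices⊆P : ∀ {v} → v ∈ vertices → P v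
      edges-sym  : ∀ i j → edges i j ≡ edges j i
      edges⊆E    : edges ⊆ᴱ E
      edges-in   : ∀ i j → edges i j ≡ true → i ∈ vertices × j ∈ vertices
      size       : suc (countEdges edges) ≡ ∣ vertices ∣
      fromRoot   : ∀ {v} → v ∈ vertices → WalkIn edges (_∈ vertices) r v
  open Tree public

  Saturated : Tree → Set
  Saturated t = ∀ {u v} → u ∈ vertices t → E u v ≡ true → P v → v ∈ vertices t

  saturated-closed : ∀ {t} → Saturated t → ∀ {u w} → WalkIn E P u w → u ∈ vertices t → w ∈ vertices t
  saturated-closed     sat (here _)     u∈ = u∈
  saturated-closed {t} sat (step _ e p) u∈ = saturated-closed {t} sat p (sat u∈ e (walk-head p))

  singleton : Tree
  singleton = record
    { vertices   = ⁅ r ⁆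
    ; edges      = λ _ _ → false
    ; root∈      = x∈⁅x⁆ r
    ; vertices⊆P = λ v∈ → subst P (sym (x∈⁅y⁆⇒x≡y r v∈)) Pr
    ; edges-sym  = λ _ _ → refl
    ; edges⊆E    = λ ()
    ; edges-in   = λ _ _ ()
    ; size       = trans (cong suc (countEdges-∅ {n})) (sym (∣⁅x⁆∣≡1 r))
    ; fromRoot   = λ v∈ → subst (WalkIn _ _ r) (sym (x∈⁅y⁆⇒x≡y r v∈)) (here (x∈⁅x⁆ r))
    }

  module Attach (t : Tree) {u v : Fin n} (u∈ : u ∈ vertices t) (v∉ : v ∉ vertices t)
                (Pv : P v) (uv : E u v ≡ true) where

    vertices′ : Subset n
    vertices′ = vertices t ∪ ⁅ v ⁆

    edges′ : Edges n
    edges′ i j = edges t i j ∨ edge u v i j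

    old : ∀ {w} → w ∈ vertices t → w ∈ vertices′
    old = x∈p∪q⁺ ∘ inj₁

    new : v ∈ vertices′
    new = x∈p∪q⁺ (inj₂ (x∈⁅x⁆ v))

    vertices′-sound : ∀ {w} → w ∈ vertices′ → w ∈ vertices t ⊎ w ≡ v
    vertices′-sound = map₂ (x∈⁅y⁆⇒x≡y v) ∘ x∈p∪q⁻ (vertices t) ⁅ v ⁆

    edges′-sound : ∀ i j → edges′ i j ≡ true → edges t i j ≡ true ⊎ (i ≡ u × j ≡ v) ⊎ (i ≡ v × j ≡ u)
    edges′-sound i j = map₂ (edge-sound i j) ∘ ∨-≡true (edges t i j)

    vertices′⊆P : ∀ {w} → w ∈ vertices′ → P w
    vertices′⊆P w∈ with vertices′-sound w∈
    ... | inj₁ w∈t  = vertices⊆P t w∈t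
    ... | inj₂ refl = Pv

    edges′⊆E : edges′ ⊆ᴱ E
    edges′⊆E {i} {j} e with edges′-sound i j e
    ... | inj₁ e′                   = edges⊆E t e′
    ... | inj₂ (inj₁ (refl , refl)) = uv
    ... | inj₂ (inj₂ (refl , refl)) = trans (E-sym v u) uv

    edges′-in : ∀ i j → edges′ i j ≡ true → i ∈ vertices′ × j ∈ vertices′
    edges′-in i j e with edges′-sound i j e
    ... | inj₁ e′ with i∈ , j∈ ← edges-in t i j e′ = old i∈ , old j∈
    ... | inj₂ (inj₁ (refl , refl)) = old u∈ , new
    ... | inj₂ (inj₂ (refl , refl)) = new , old u∈

    lift : ∀ {w} → WalkIn (edges t) (_∈ vertices t) r w → WalkIn edges′ (_∈ vertices′) r w
    lift = walk-map (λ {i} {j} e → cong (_∨ edge u v i j) e) old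

    size′ : suc (countEdges edges′) ≡ ∣ vertices′ ∣
    size′ = begin
      suc (countEdges edges′)                            ≡⟨ cong suc (countEdges-∨ (edges t) (edge u v) disjoint) ⟩
      suc (countEdges (edges t) + countEdges (edge u v)) ≡⟨ cong (λ m → suc (countEdges (edges t) + m)) (countEdges-edge u≢v) ⟩
      suc (countEdges (edges t) + 1)                     ≡⟨ cong suc (+-comm _ 1) ⟩
      suc (suc (countEdges (edges t)))                   ≡⟨ cong suc (size t) ⟩
      suc ∣ vertices t ∣                                  ≡⟨ sym (∣p∪⁅x⁆∣≡1+∣p∣ (vertices t) v∉) ⟩
      ∣ vertices′ ∣                                       ∎
      where
        open ≡-Reasoning
        u≢v : u ≢ v
        u≢v refl = v∉ u∈
        disjoint : ∀ i j → edges t i j ≡ true → edge u v i j ≡ true → ⊥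
        disjoint i j e e′ with edges-in t i j e | edge-sound i j e′
        ... | _ , j∈ | inj₁ (_ , refl) = v∉ j∈
        ... | i∈ , _ | inj₂ (refl , _) = v∉ i∈

    fromRoot′ : ∀ {w} → w ∈ vertices′ → WalkIn edges′ (_∈ vertices′) r w
    fromRoot′ w∈ with vertices′-sound w∈
    ... | inj₁ w∈t  = lift (fromRoot t w∈t)
    ... | inj₂ refl = lift (fromRoot t u∈) ++ʷ step (old u∈) uv′ (here new)
      where
        uv′ : edges′ u v ≡ true
        uv′ = trans (cong (edges t u v ∨_) (edge-complete u v)) (∨-zeroʳ _)

  attach : (t : Tree) {u v : Fin n} → u ∈ vertices t → v ∉ vertices t → P v → E u v ≡ true → Tree
  attach t u∈ v∉ Pv uv = record
    { vertices   = vertices′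
    ; edges      = edges′
    ; root∈      = old (root∈ t)
    ; vertices⊆P = vertices′⊆P
    ; edges-sym  = λ i j → cong₂ _∨_ (edges-sym t i j) (edge-sym _ _ i j)
    ; edges⊆E    = edges′⊆E
    ; edges-in   = edges′-in
    ; size       = size′
    ; fromRoot   = fromRoot′
    }
    where open Attach t u∈ v∉ Pv uv

  Frontier : Tree → Fin n → Fin n → Set
  Frontier t u v = u ∈ vertices t × v ∉ vertices t × P v × E u v ≡ true

  frontier? : ∀ t → Dec (∃ λ u → ∃ λ v → Frontier t u v)
  frontier? t = any? λ u → any? λ v →
    (u ∈? vertices t) ×-dec (¬? (v ∈? vertices t)) ×-dec P? v ×-dec (E u v ≟ᴮ true)

  grow : ∀ fuel (t : Tree) → n ≤ ∣ vertices t ∣ + fuel → Σ Tree Saturated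
  grow fuel t bound with frontier? t
  ... | no none = t , λ {u} {v} u∈ uv Pv →
    decidable-stable (v ∈? vertices t) λ v∉ → none (u , v , u∈ , v∉ , Pv , uv)
  grow zero t bound | yes (u , v , u∈ , v∉ , Pv , uv) = ⊥-elim (1+n≰n (begin
    suc n                     ≤⟨ s≤s bound ⟩
    suc (∣ vertices t ∣ + 0)  ≡⟨ cong suc (+-identityʳ _) ⟩
    suc ∣ vertices t ∣        ≡⟨ sym (∣p∪⁅x⁆∣≡1+∣p∣ (vertices t) v∉) ⟩
    ∣ vertices t ∪ ⁅ v ⁆ ∣    ≤⟨ ∣p∣≤n (vertices t ∪ ⁅ v ⁆) ⟩
    n                         ∎))
    where open ≤-Reasoning
  grow (suc fuel) t bound | yes (u , v , u∈ , v∉ , Pv , uv) =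
    grow fuel (attach t u∈ v∉ Pv uv) (begin
      n                               ≤⟨ bound ⟩
      ∣ vertices t ∣ + suc fuel       ≡⟨ +-suc _ fuel ⟩
      suc ∣ vertices t ∣ + fuel       ≡⟨ cong (_+ fuel) (sym (∣p∪⁅x⁆∣≡1+∣p∣ (vertices t) v∉)) ⟩
      ∣ vertices t ∪ ⁅ v ⁆ ∣ + fuel   ∎)
    where open ≤-Reasoning

  maximalTree : Σ Tree Saturated
  maximalTree = grow n singleton (subst (n ≤_) (cong (_+ n) (sym (∣⁅x⁆∣≡1 r))) (n≤1+n n))

  tree : Tree
  tree = proj₁ maximalTree

  reach⇒∈tree : ∀ {v} → WalkIn E P r v → v ∈ vertices tree
  reach⇒∈tree p = saturated-closed {tree} (proj₂ maximalTree) p (root∈ tree)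

  reachable? : Dec (∀ v → P v → WalkIn E P r v)
  reachable? with all? (λ v → P? v →-dec (v ∈? vertices tree))
  ... | yes all∈ = yes λ v Pv → walk-map (edges⊆E tree) (vertices⊆P tree) (fromRoot tree (all∈ v Pv))
  ... | no ¬all∈ = no λ reach → ¬all∈ λ v Pv → reach⇒∈tree (reach v Pv)

-- Steiner distances of (n - 1)-sets

∣p∣<n⇒∃∉ : ∀ {n} (p : Subset n) → ∣ p ∣ < n → ∃ (_∉ p)
∣p∣<n⇒∃∉ (outside ∷ p) _         = zero , λ ()
∣p∣<n⇒∃∉ (inside  ∷ p) (s≤s ∣p∣<n) with ∣p∣<n⇒∃∉ p ∣p∣<n
... | x , x∉p = suc x , λ { (there x∈p) → x∉p x∈p }

∈∁⁅y⁆⇒≢ : ∀ {n} {x y : Fin n} → x ∈ ∁ ⁅ y ⁆ → x ≢ y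
∈∁⁅y⁆⇒≢ = x∉⁅y⁆⇒x≢y ∘ x∈∁p⇒x∉p

≢⇒∈∁⁅y⁆ : ∀ {n} {x y : Fin n} → x ≢ y → x ∈ ∁ ⁅ y ⁆
≢⇒∈∁⁅y⁆ = x∉p⇒x∈∁p ∘ x≢y⇒x∉⁅y⁆

∣∁⁅x⁆∣≡n∸1 : ∀ {n} (x : Fin n) → ∣ ∁ ⁅ x ⁆ ∣ ≡ n ∸ 1
∣∁⁅x⁆∣≡n∸1 {n} x = trans (∣∁p∣≡n∸∣p∣ ⁅ x ⁆) (cong (n ∸_) (∣⁅x⁆∣≡1 x))

∣U∣≤1+edgeCount : ∀ {n} {G : Graph n} (H : Subgraph G) → SubConnected H →
                  ∀ {r} → r ∈ U H → ∣ U H ∣ ≤ suc (edgeCount H)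
∣U∣≤1+edgeCount H connected {r} r∈ = begin
  ∣ U H ∣                        ≤⟨ p⊆q⇒∣p∣≤∣q∣ (λ v∈ → reach⇒∈tree (connected r _ r∈ v∈)) ⟩
  ∣ vertices tree ∣              ≡⟨ sym (size tree) ⟩
  suc (countEdges (edges tree))  ≤⟨ s≤s (countEdges-mono {E = edges tree} {E′ = E H} (edges⊆E tree)) ⟩
  suc (edgeCount H)              ∎
  where
    open ≤-Reasoning
    open SpanningTree (E H) (E-sym H) (_∈? U H) r r∈

module _ {n : ℕ} (G : Graph n) where

  spanningTree : (W : Subset n) {r : Fin n} → r ∈ W → (∀ {v} → v ∈ W → WalkIn (adj G) (_∈ W) r v) →
    Σ (Subgraph G) λ H → SubConnected H × U H ≡ W × suc (edgeCount H) ≡ ∣ W ∣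
  spanningTree W {r} r∈ reach = H , connected , U≡W , trans (size tree) (cong ∣_∣ U≡W)
    where
      open SpanningTree (adj G) (adj-sym G) (_∈? W) r r∈
      H : Subgraph G
      H = record { U = vertices tree ; E = edges tree ; E-sym = edges-sym tree
                 ; E-sub = λ i j e → edges⊆E tree e , edges-in tree i j e }
      connected : SubConnected H
      connected u v u∈ v∈ = walk-via (edges-sym tree) (fromRoot tree u∈) (fromRoot tree v∈)
      U≡W : U H ≡ W
      U≡W = ⊆-antisym (vertices⊆P tree) (reach⇒∈tree ∘ reach)

  spanningTree-G : Connected G → Fin n →
    Σ (Subgraph G) λ H → SubConnected H × U H ≡ ⊤ × edgeCount H ≡ n ∸ 1
  spanningTree-G connected r with spanningTree ⊤ ∈⊤ (λ {v} _ → walk-map id (λ _ → ∈⊤) (connected r v))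
  ... | H , H-connected , U≡⊤ , size = H , H-connected , U≡⊤ , cong (_∸ 1) (trans size (∣⊤∣≡n n))

  spanningTree-G-x : ∀ {x r} → ConnectedWithout G x → r ≢ x →
    Σ (Subgraph G) λ H → SubConnected H × U H ≡ ∁ ⁅ x ⁆ × edgeCount H ≡ n ∸ 2
  spanningTree-G-x {x} {r} connected-x r≢x
    with spanningTree (∁ ⁅ x ⁆) (≢⇒∈∁⁅y⁆ r≢x)
           (λ v∈ → walk-map id ≢⇒∈∁⁅y⁆ (connected-x r _ r≢x (∈∁⁅y⁆⇒≢ v∈)))
  ... | H , H-connected , U≡∁⁅x⁆ , size =
    H , H-connected , U≡∁⁅x⁆ , trans (cong (_∸ 1) (trans size (∣∁⁅x⁆∣≡n∸1 x))) (∸-+-assoc n 1 1)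

  connectedWithout? : ∀ x {r} → r ≢ x → Dec (ConnectedWithout G x)
  connectedWithout? x {r} r≢x = map′
    (λ reach u v u≢x v≢x → walk-via (adj-sym G) (reach u u≢x) (reach v v≢x))
    (λ connected-x v v≢x → connected-x r v r≢x v≢x)
    reachable?
    where open SpanningTree (adj G) (adj-sym G) (λ v → ¬? (v ≟ x)) r r≢x

  cutVertex∈ : ∀ {x} → IsCutVertex G x → (H : Subgraph G) → SubConnected H → ∁ ⁅ x ⁆ ⊆ U H → x ∈ U H
  cutVertex∈ {x} cut H connected ∁⁅x⁆⊆U = decidable-stable (x ∈? U H) λ x∉U → cut λ u v u≢x v≢x →
    walk-map (λ {i} {j} e → proj₁ (E-sub H i j e)) (λ { w∈U refl → x∉U w∈U })
             (connected u v (∁⁅x⁆⊆U (≢⇒∈∁⁅y⁆ u≢x)) (∁⁅x⁆⊆U (≢⇒∈∁⁅y⁆ v≢x)))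

  steinerDist≤n∸1 : Connected G → Fin n → ∀ {S d} → IsSteinerDist G S d → d ≤ n ∸ 1
  steinerDist≤n∸1 connected r (_ , minimal) with spanningTree-G connected r
  ... | H , H-connected , refl , size = subst (_ ≤_) size (minimal H H-connected ⊆⊤)

  steinerDist≤n∸2 : ∀ {x r} → ConnectedWithout G x → r ≢ x → ∀ {S d} → x ∉ S → IsSteinerDist G S d → d ≤ n ∸ 2
  steinerDist≤n∸2 connected-x r≢x x∉S (_ , minimal) with spanningTree-G-x connected-x r≢x
  ... | H , H-connected , refl , size =
    subst (_ ≤_) size (minimal H H-connected λ v∈S → ≢⇒∈∁⁅y⁆ λ { refl → x∉S v∈S })

  steinerDist-cutVertex : ∀ {x} → Connected G → IsCutVertex G x → IsSteinerDist G (∁ ⁅ x ⁆) (n ∸ 1)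
  steinerDist-cutVertex {x} connected cut with spanningTree-G connected x
  ... | H₀ , H₀-connected , refl , size = (H₀ , H₀-connected , ⊆⊤ , size) , minimal
    where
      minimal : ∀ H → SubConnected H → ∁ ⁅ x ⁆ ⊆ U H → n ∸ 1 ≤ edgeCount H
      minimal H connected ∁⁅x⁆⊆U = ∸-monoˡ-≤ 1 (begin
        n                  ≡⟨ sym (∣⊤∣≡n n) ⟩
        ∣ ⊤ {n} ∣          ≤⟨ p⊆q⇒∣p∣≤∣q∣ all∈U ⟩
        ∣ U H ∣            ≤⟨ ∣U∣≤1+edgeCount H connected x∈U ⟩
        suc (edgeCount H)  ∎)
        where
          open ≤-Reasoning
          x∈U = cutVertex∈ cut H connected ∁⁅x⁆⊆U
          all∈U : ⊤ ⊆ U H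
          all∈U {v} _ with v ≟ x
          ... | yes refl = x∈U
          ... | no v≢x   = ∁⁅x⁆⊆U (≢⇒∈∁⁅y⁆ v≢x)

  steinerDist-nonCutVertex : ∀ {x r} → ConnectedWithout G x → r ≢ x → IsSteinerDist G (∁ ⁅ x ⁆) (n ∸ 2)
  steinerDist-nonCutVertex {x} {r} connected-x r≢x with spanningTree-G-x connected-x r≢x
  ... | H₀ , H₀-connected , refl , size = (H₀ , H₀-connected , id , size) , minimal
    where
      minimal : ∀ H → SubConnected H → ∁ ⁅ x ⁆ ⊆ U H → n ∸ 2 ≤ edgeCount H
      minimal H connected ∁⁅x⁆⊆U = subst (_≤ edgeCount H) (∸-+-assoc n 1 1) (∸-monoˡ-≤ 1 (begin
        n ∸ 1              ≡⟨ sym (∣∁⁅x⁆∣≡n∸1 x) ⟩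
        ∣ ∁ ⁅ x ⁆ ∣        ≤⟨ p⊆q⇒∣p∣≤∣q∣ ∁⁅x⁆⊆U ⟩
        ∣ U H ∣            ≤⟨ ∣U∣≤1+edgeCount H connected (∁⁅x⁆⊆U (≢⇒∈∁⁅y⁆ r≢x)) ⟩
        suc (edgeCount H)  ∎))
        where open ≤-Reasoning

∃≢ : ∀ {m} (x : Fin (suc (suc m))) → ∃ (_≢ x)
∃≢ zero    = suc zero , λ ()
∃≢ (suc x) = zero , λ ()

module _ {k : ℕ} (G : Graph (3 + k)) where

  outsideVertex : ∀ S → ∣ S ∣ ≡ 2 + k → ∃ (_∉ S)
  outsideVertex S ∣S∣≡2+k = ∣p∣<n⇒∃∉ S (subst (_< 3 + k) (sym ∣S∣≡2+k) ≤-refl)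

  twoConnected⇒sdiam : TwoConnected G → IsSdiam G (2 + k) (1 + k)
  twoConnected⇒sdiam (_ , _ , connected-x) =
    (∁ ⁅ zero ⁆ , ∣∁⁅x⁆∣≡n∸1 zero , steinerDist-nonCutVertex G (connected-x zero) (proj₂ (∃≢ zero))) ,
    λ S ∣S∣≡2+k _ dS → let x , x∉S = outsideVertex S ∣S∣≡2+k in
      steinerDist≤n∸2 G (connected-x x) (proj₂ (∃≢ x)) x∉S dS

  sdiam⇒twoConnected : Connected G → IsSdiam G (2 + k) (1 + k) → TwoConnected G
  sdiam⇒twoConnected connected (_ , maximal) = s≤s (s≤s (s≤s z≤n)) , connected , λ x →
    decidable-stable (connectedWithout? G x (proj₂ (∃≢ x))) λ cut →
      1+n≰n (maximal (∁ ⁅ x ⁆) (∣∁⁅x⁆∣≡n∸1 x) _ (steinerDist-cutVertex G connected cut))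

  cutVertex⇒sdiam : Connected G → HasCutVertex G → IsSdiam G (2 + k) (2 + k)
  cutVertex⇒sdiam connected (x , cut) =
    (∁ ⁅ x ⁆ , ∣∁⁅x⁆∣≡n∸1 x , steinerDist-cutVertex G connected cut) ,
    λ _ _ _ → steinerDist≤n∸1 G connected x

  sdiam⇒cutVertex : IsSdiam G (2 + k) (2 + k) → HasCutVertex G
  sdiam⇒cutVertex ((S , ∣S∣≡2+k , dS) , _) with outsideVertex S ∣S∣≡2+k
  ... | x , x∉S = x , λ connected-x → 1+n≰n (steinerDist≤n∸2 G connected-x (proj₂ (∃≢ x)) x∉S dS)

corollary2 : ∀ {n : ℕ} (G : Graph n) → 3 ≤ n → Connected G →
    (IsSdiam G (n ∸ 1) (n ∸ 2) ⇔ TwoConnected G)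
    × (IsSdiam G (n ∸ 1) (n ∸ 1) ⇔ HasCutVertex G)
corollary2 G (s≤s (s≤s (s≤s _))) connected =
  mk⇔ (sdiam⇒twoConnected G connected) (twoConnected⇒sdiam G) ,
  mk⇔ (sdiam⇒cutVertex G) (cutVertex⇒sdiam G connected)
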